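{- Let $\Gamma$ be a simplicial complex on $[n]$ and $1\le i<j\le n$. The following are equivalent: (i) $\Gamma$ satisfies the Link condition with respect to $\{i,j\}$; (ii) $\mathrm{Shift}_{ij}(\Gamma)=\mathcal C_\Gamma(i,j)\cup\{\{i\}\cup F: F\in\{j\}*\mathrm{lk}_\Gamma(\{i,j\})\}$; (iii) the Stanley–Reisner ideal $I_\Gamma$ has no minimal monomial generator divisible by $x_ix_j$. In particular, if $\Gamma$ satisfies the Link condition with respect to $\{i,j\}$ then $\mathrm{Shift}_{ij}(\Gamma)$ also satisfies the Link condition with respect to $\{i,j\}$.
   Context: A simplicial complex on $[n]$: collection of subsets of $[n]$ containing all singletons and closed under subsets. $\mathrm{lk}_\Gamma(F)=\{G\subset[n]\setminus F: G\cup F\in\Gamma\}$, $\mathrm{lk}_\Gamma(v)=\mathrm{lk}_\Gamma(\{v\})$. Contraction: $\mathcal C_\Gamma(i,j)=\{F\in\Gamma: i\notin F\}\cup\{(F\setminus\{i\})\cup\{j\}: i\in F\in\Gamma\}$. Link condition w.r.t. $\{i,j\}$: $\mathrm{lk}_\Gamma(i)\cap\mathrm{lk}_\Gamma(j)=\mathrm{lk}_\Gamma(\{i,j\})$. For $F\in\Gamma$, $C_{ij}(F)=(F\setminus\{i\})\cup\{j\}$ if $i\in F$, $j\notin F$ and $(F\setminus\{i\})\cup\{j\}\notin\Gamma$, and $C_{ij}(F)=F$ otherwise; $\mathrm{Shift}_{ij}(\Gamma)=\{C_{ij}(F):F\in\Gamma\}$. For a set $V$ and a complex $\Sigma$ on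 a vertex set disjoint from $V$, $V*\Sigma=\{F\cup G: F\subset V, G\in\Sigma\}$. $I_\Gamma\subset K[x_1,\dots,x_n]$ ($K$ a field) is generated by $x_F=\prod_{k\in F}x_k$ for $F\subset[n]$, $F\notin\Gamma$. -}

module Defs where

open import Data.Bool using (Bool; true; false; if_then_else_)
open import Data.Nat using (ℕ; _≤_; _≥_)
open import Data.Fin using (Fin)
open import Data.Fin.Subset using (Subset; _∈_; _∉_; _⊆_; _∪_; _-_; ⁅_⁆)
open import Data.Fin.Subset.Properties using (_∈?_)
open import Data.Product using (Σ; ∃; _×_; _,_)
open import Data.Sum using (_⊎_)
open import Relation.Nullary using (¬_; yes; no)
open import Relation.Binary.PropositionalEquality using (_≡_; _≢_)
open import Function.Bundles using (_⇔_)

-- A complex Γ on [n] = Fin n is given by its (decidable) membership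
-- function on subsets of [n]; F ∈ Γ means Γ F ≡ true.
Complex : ℕ → Set
Complex n = Subset n → Bool

Family : ℕ → Set₁
Family n = Subset n → Set

⟦_⟧ : ∀ {n} → Complex n → Family n
⟦ Γ ⟧ F = Γ F ≡ true

record IsSimplicialComplex {n : ℕ} (Γ : Complex n) : Set where
  field
    singletons : ∀ (v : Fin n) → ⟦ Γ ⟧ ⁅ v ⁆
    downClosed : ∀ (F G : Subset n) → G ⊆ F → ⟦ Γ ⟧ F → ⟦ Γ ⟧ G

_≐_ : ∀ {n} → Family n → Family n → Set
A ≐ B = ∀ F → (A F ⇔ B F)

Disjoint : ∀ {n} → Subset n → Subset n → Set
Disjoint A B = ∀ k → k ∈ A → k ∉ B

lk : ∀ {n} → Family n → Subset n → Family n
lk Γ F G = Disjoint G F × Γ (G ∪ F)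

LinkCondition : ∀ {n} → Family n → Fin n → Fin n → Set
LinkCondition Γ i j =
  (λ G → lk Γ ⁅ i ⁆ G × lk Γ ⁅ j ⁆ G) ≐ lk Γ (⁅ i ⁆ ∪ ⁅ j ⁆)

Contraction : ∀ {n} → Family n → Fin n → Fin n → Family n
Contraction {n} Γ i j G =
  (Γ G × i ∉ G) ⊎ (Σ (Subset n) λ F → Γ F × i ∈ F × G ≡ (F - i) ∪ ⁅ j ⁆)

Cij : ∀ {n} → Complex n → Fin n → Fin n → Subset n → Subset n
Cij Γ i j F with i ∈? F | j ∈? F
... | yes _ | no _ = if Γ ((F - i) ∪ ⁅ j ⁆) then F else ((F - i) ∪ ⁅ j ⁆)
... | _ | _ = F

Shift : ∀ {n} → Complex n → Fin n → Fin n → Family n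
Shift Γ i j G = Σ _ λ F → ⟦ Γ ⟧ F × Cij Γ i j F ≡ G

join : ∀ {n} → Subset n → Family n → Family n
join V Σ' H = Σ _ λ F → Σ _ λ G → F ⊆ V × Σ' G × H ≡ F ∪ G

_∪ᶠ_ : ∀ {n} → Family n → Family n → Family n
(A ∪ᶠ B) F = A F ⊎ B F

addVertex : ∀ {n} → Fin n → Family n → Family n
addVertex i Σ' H = Σ _ λ F → Σ' F × H ≡ ⁅ i ⁆ ∪ F

-- Monomials in K[x_1..x_n] as exponent vectors; divisibility is componentwise ≤.
Monomial : ℕ → Set
Monomial n = Fin n → ℕ

_∣ᵐ_ : ∀ {n} → Monomial n → Monomial n → Set
a ∣ᵐ b = ∀ k → a k ≤ b k

SqfreeDivides : ∀ {n} → Subset n → Monomial n → Set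
SqfreeDivides F a = ∀ k → k ∈ F → a k ≥ 1

-- A monomial lies in the monomial ideal I_Γ = (x_F : F ∉ Γ) iff it is
-- divisible by some generator x_F.
InSR : ∀ {n} → Complex n → Monomial n → Set
InSR Γ a = Σ _ λ F → ¬ ⟦ Γ ⟧ F × SqfreeDivides F a

MinimalGenerator : ∀ {n} → Complex n → Monomial n → Set
MinimalGenerator Γ a = InSR Γ a × (∀ b → b ∣ᵐ a → InSR Γ b → ∀ k → b k ≡ a k)

DivisibleByxixj : ∀ {n} → Fin n → Fin n → Monomial n → Set
DivisibleByxixj i j a = a i ≥ 1 × a j ≥ 1

∃Min : ∀ {n} → Complex n → Fin n → Fin n → Set
∃Min Γ i j = Σ _ λ a → MinimalGenerator Γ a × DivisibleByxixj i j a

{-# OPTIONS --safe #-}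
-- The link condition says that G ∪ {i}, G ∪ {j} ∈ Γ imply G ∪ {i,j} ∈ Γ; for a simplicial
-- complex G need not avoid {i,j}. The family {i} ∪ ({j} * lk({i,j})) is just
-- {X ∋ i : X ∪ {j} ∈ Γ}, and no contracted face contains i. Shifting fixes every face except
-- the F ∋ i with j ∉ F and (F - i) ∪ {j} ∉ Γ, which become contracted faces; so the description
-- (ii) amounts to: every fixed face F ∋ i has F ∪ {j} ∈ Γ. For F = G ∪ {i} with G ∪ {j} ∈ Γ
-- this is exactly the link condition. Under it, a set X ∋ i lies in Shift_ij(Γ) iff
-- X ∪ {j} ∈ Γ, which yields the link condition for the shift.
-- The minimal generators of I_Γ are the x_F for minimal non-faces F. A minimal non-face
-- containing i and j violates the link condition (take G = F - {i,j}), and conversely a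
-- violation G ∪ {i,j} ∉ Γ contains a minimal non-face, which must contain both i and j.
module Submission where

open import Defs
open import Data.Bool using (true; false)
open import Data.Bool.Properties using (not-¬)
open import Data.Nat using (ℕ; z≤n; s≤s) renaming (_≤_ to _≤ℕ_)
open import Data.Nat.Properties using (≤-antisym; ≤-trans; n≤0⇒n≡0; 0≢1+n)
open import Data.Fin using (Fin; _<_)
open import Data.Fin.Properties using (<⇒≢)
open import Data.Fin.Subset using (Subset; ⁅_⁆; _∪_; _∩_; _∈_; _∉_; _⊆_; _-_; _─_)
open import Data.Fin.Subset.Properties
  using (_∈?_; x∈p∪q⁻; p⊆p∪q; q⊆p∪q; x∈p∩q⁻; x∈p∩q⁺; x∈⁅x⁆; x∈⁅y⁆⇒x≡y; x∉⁅y⁆⇒x≢y;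
         p─q⊆p; x∈p∧x∉q⇒x∈p─q; x∈p∧x≢y⇒x∈p-y; p─x─y≡p─y─x; ⊆-refl; ⊆-trans; ⊆-reflexive; ⊆-antisym)
open import Data.Vec using (_∷_; here; there)
open import Data.List using (List; []; _∷_; allFin)
open import Data.List.Membership.Propositional using () renaming (_∈_ to _∈ₗ_)
open import Data.List.Membership.Propositional.Properties using (∈-allFin)
open import Data.List.Relation.Unary.Any using (here; there)
open import Data.Product using (Σ; _×_; _,_; proj₁; proj₂)
open import Data.Sum using (_⊎_; inj₁; inj₂; [_,_])
open import Data.Empty using (⊥-elim)
open import Relation.Nullary using (¬_; yes; no)
open import Relation.Binary.PropositionalEquality using (_≡_; _≢_; refl; sym; subst; module ≡-Reasoning)
open import Function using (_∘_)
open import Function.Bundles using (_⇔_; mk⇔; Equivalence)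

open Equivalence

module _ {n : ℕ} where

  ∈∪⁻ : ∀ {p q : Subset n} {x} → x ∈ p ∪ q → x ∈ p ⊎ x ∈ q
  ∈∪⁻ {p} {q} = x∈p∪q⁻ p q

  ⊆∪ˡ : ∀ {p q : Subset n} → p ⊆ p ∪ q
  ⊆∪ˡ {q = q} = p⊆p∪q q

  ⊆∪ʳ : ∀ {p q : Subset n} → q ⊆ p ∪ q
  ⊆∪ʳ {p} {q} = q⊆p∪q p q

  ∈─⁻ : ∀ {p q : Subset n} {x} → x ∈ p ─ q → x ∈ p × x ∉ q
  ∈─⁻ {p = p} {q} x∈p─q = p─q⊆p p q x∈p─q , ∉q {p = p} x∈p─q
    where
    ∉q : ∀ {m} {p q : Subset m} {x} → x ∈ p ─ q → x ∉ q
    ∉q {p = _ ∷ _} {true ∷ _} () here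
    ∉q {p = _ ∷ _} {_ ∷ q} (there x∈p─q) (there x∈q) = ∉q {q = q} x∈p─q x∈q

  ∈-⁻ : ∀ {p : Subset n} {x y} → x ∈ p - y → x ∈ p × x ≢ y
  ∈-⁻ x∈p-y with ∈─⁻ x∈p-y
  ... | x∈p , x∉⁅y⁆ = x∈p , x∉⁅y⁆⇒x≢y x∉⁅y⁆

  ∪-lub : ∀ {p q r : Subset n} → p ⊆ r → q ⊆ r → p ∪ q ⊆ r
  ∪-lub p⊆r q⊆r x∈p∪q with ∈∪⁻ x∈p∪q
  ... | inj₁ x∈p = p⊆r x∈p
  ... | inj₂ x∈q = q⊆r x∈q

  ∪-monoˡ : ∀ {p q r : Subset n} → p ⊆ q → p ∪ r ⊆ q ∪ r
  ∪-monoˡ p⊆q = ∪-lub (⊆∪ˡ ∘ p⊆q) ⊆∪ʳ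

  x∈p⇒⁅x⁆⊆p : ∀ {p : Subset n} {x} → x ∈ p → ⁅ x ⁆ ⊆ p
  x∈p⇒⁅x⁆⊆p {x = x} x∈p y∈⁅x⁆ = subst (_∈ _) (sym (x∈⁅y⁆⇒x≡y x y∈⁅x⁆)) x∈p

  p⊆p─q∪q : ∀ {p q : Subset n} → p ⊆ (p ─ q) ∪ q
  p⊆p─q∪q {q = q} {x} x∈p with x ∈? q
  ... | yes x∈q = ⊆∪ʳ x∈q
  ... | no x∉q = ⊆∪ˡ (x∈p∧x∉q⇒x∈p─q x∈p x∉q)

  p⊆q∪⁅x⁆∧x∉p⇒p⊆q : ∀ {p q : Subset n} {x} → p ⊆ q ∪ ⁅ x ⁆ → x ∉ p → p ⊆ q
  p⊆q∪⁅x⁆∧x∉p⇒p⊆q p⊆q∪x x∉p y∈p with ∈∪⁻ (p⊆q∪x y∈p)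
  ... | inj₁ y∈q = y∈q
  ... | inj₂ y∈x = ⊥-elim (x∉p (subst (_∈ _) (x∈⁅y⁆⇒x≡y _ y∈x) y∈p))

  p∪q─q⊆p : ∀ {p q : Subset n} → (p ∪ q) ─ q ⊆ p
  p∪q─q⊆p x∈p∪q─q with ∈─⁻ x∈p∪q─q
  ... | x∈p∪q , x∉q with ∈∪⁻ x∈p∪q
  ...   | inj₁ x∈p = x∈p
  ...   | inj₂ x∈q = ⊥-elim (x∉q x∈q)

  p⊆q⇒p-x⊆q-x : ∀ {p q : Subset n} {x} → p ⊆ q → p - x ⊆ q - x
  p⊆q⇒p-x⊆q-x p⊆q y∈p-x with ∈-⁻ y∈p-x
  ... | y∈p , y≢x = x∈p∧x≢y⇒x∈p-y (p⊆q y∈p) y≢x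

  DownClosed : Family n → Set
  DownClosed Φ = ∀ {F G} → G ⊆ F → Φ F → Φ G

  LinkClosed : Family n → Fin n → Fin n → Set
  LinkClosed Φ i j = ∀ G → Φ (G ∪ ⁅ i ⁆) → Φ (G ∪ ⁅ j ⁆) → Φ ((G ∪ ⁅ i ⁆) ∪ ⁅ j ⁆)

  MinimalNonFace : Family n → Subset n → Set
  MinimalNonFace Φ F = ¬ Φ F × (∀ k → k ∈ F → Φ (F - k))

  linkCondition-intro : ∀ {Φ : Family n} {i j} →
    (∀ G → Disjoint G (⁅ i ⁆ ∪ ⁅ j ⁆) → Φ (G ∪ ⁅ i ⁆) → Φ (G ∪ ⁅ j ⁆) → Φ (G ∪ (⁅ i ⁆ ∪ ⁅ j ⁆))) →
    (∀ G → Disjoint G (⁅ i ⁆ ∪ ⁅ j ⁆) → Φ (G ∪ (⁅ i ⁆ ∪ ⁅ j ⁆)) → Φ (G ∪ ⁅ i ⁆) × Φ (G ∪ ⁅ j ⁆)) →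
    LinkCondition Φ i j
  linkCondition-intro merge split G = mk⇔
    (λ ((G∩i=∅ , ΦGi) , (G∩j=∅ , ΦGj)) →
      let G∩ij=∅ = λ k k∈G → [ G∩i=∅ k k∈G , G∩j=∅ k k∈G ] ∘ ∈∪⁻ in
      G∩ij=∅ , merge G G∩ij=∅ ΦGi ΦGj)
    (λ (G∩ij=∅ , ΦGij) →
      ((λ k k∈G → G∩ij=∅ k k∈G ∘ ⊆∪ˡ) , proj₁ (split G G∩ij=∅ ΦGij)) ,
      ((λ k k∈G → G∩ij=∅ k k∈G ∘ ⊆∪ʳ) , proj₂ (split G G∩ij=∅ ΦGij)))

  module _ {Φ : Family n} (dc : DownClosed Φ) {i j : Fin n} where

    linkCondition⇒linkClosed : LinkCondition Φ i j → LinkClosed Φ i j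
    linkCondition⇒linkClosed lc G ΦGi ΦGj = dc G∪ij⊆G′∪ij (proj₂ (to (lc G′) (lk-i , lk-j)))
      where
      G′ = G ─ (⁅ i ⁆ ∪ ⁅ j ⁆)
      lk-i : lk Φ ⁅ i ⁆ G′
      lk-i = (λ k k∈G′ → proj₂ (∈─⁻ k∈G′) ∘ ⊆∪ˡ) , dc (∪-monoˡ (proj₁ ∘ ∈─⁻)) ΦGi
      lk-j : lk Φ ⁅ j ⁆ G′
      lk-j = (λ k k∈G′ → proj₂ (∈─⁻ k∈G′) ∘ ⊆∪ʳ) , dc (∪-monoˡ (proj₁ ∘ ∈─⁻)) ΦGj
      G∪ij⊆G′∪ij : (G ∪ ⁅ i ⁆) ∪ ⁅ j ⁆ ⊆ G′ ∪ (⁅ i ⁆ ∪ ⁅ j ⁆)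
      G∪ij⊆G′∪ij = ∪-lub (∪-lub p⊆p─q∪q (⊆∪ʳ ∘ ⊆∪ˡ)) (⊆∪ʳ ∘ ⊆∪ʳ)

    linkClosed⇒linkCondition : LinkClosed Φ i j → LinkCondition Φ i j
    linkClosed⇒linkCondition closed = linkCondition-intro {Φ = Φ}
      (λ G _ ΦGi ΦGj → dc (∪-lub (⊆∪ˡ ∘ ⊆∪ˡ) (∪-monoˡ ⊆∪ʳ)) (closed G ΦGi ΦGj))
      (λ G _ ΦGij → dc (∪-lub ⊆∪ˡ (⊆∪ʳ ∘ ⊆∪ˡ)) ΦGij , dc (∪-lub ⊆∪ˡ (⊆∪ʳ ∘ ⊆∪ʳ)) ΦGij)

    addVertex-join-lk : ∀ X →
      addVertex i (join ⁅ j ⁆ (lk Φ (⁅ i ⁆ ∪ ⁅ j ⁆))) X ⇔ (i ∈ X × Φ (X ∪ ⁅ j ⁆))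
    addVertex-join-lk X = mk⇔ from-join to-join
      where
      from-join : addVertex i (join ⁅ j ⁆ (lk Φ (⁅ i ⁆ ∪ ⁅ j ⁆))) X → i ∈ X × Φ (X ∪ ⁅ j ⁆)
      from-join (_ , (F , G , F⊆j , (_ , ΦG∪ij) , refl) , refl) =
        ⊆∪ˡ (x∈⁅x⁆ i) ,
        dc (∪-lub (∪-lub (⊆∪ʳ ∘ ⊆∪ˡ) (∪-lub (⊆∪ʳ ∘ ⊆∪ʳ ∘ F⊆j) ⊆∪ˡ)) (⊆∪ʳ ∘ ⊆∪ʳ)) ΦG∪ij
      to-join : i ∈ X × Φ (X ∪ ⁅ j ⁆) → addVertex i (join ⁅ j ⁆ (lk Φ (⁅ i ⁆ ∪ ⁅ j ⁆))) X
      to-join (i∈X , ΦX∪j) =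
        _ , (X ∩ ⁅ j ⁆ , X ─ (⁅ i ⁆ ∪ ⁅ j ⁆) , proj₂ ∘ x∈p∩q⁻ X ⁅ j ⁆ ,
             ((λ k → proj₂ ∘ ∈─⁻) ,
              dc (∪-lub (⊆∪ˡ ∘ proj₁ ∘ ∈─⁻) (∪-monoˡ (x∈p⇒⁅x⁆⊆p i∈X))) ΦX∪j) , refl) ,
        ⊆-antisym X⊆ (∪-lub (x∈p⇒⁅x⁆⊆p i∈X) (∪-lub (proj₁ ∘ x∈p∩q⁻ X ⁅ j ⁆) (proj₁ ∘ ∈─⁻)))
        where
        X⊆ : X ⊆ ⁅ i ⁆ ∪ ((X ∩ ⁅ j ⁆) ∪ (X ─ (⁅ i ⁆ ∪ ⁅ j ⁆)))
        X⊆ {k} k∈X with k ∈? ⁅ i ⁆ ∪ ⁅ j ⁆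
        ... | no k∉ij = ⊆∪ʳ (⊆∪ʳ (x∈p∧x∉q⇒x∈p─q k∈X k∉ij))
        ... | yes k∈ij with ∈∪⁻ k∈ij
        ...   | inj₁ k∈i = ⊆∪ˡ k∈i
        ...   | inj₂ k∈j = ⊆∪ʳ (⊆∪ˡ (x∈p∩q⁺ (k∈X , k∈j)))

  contraction-∌ : ∀ {Φ : Family n} {i j X} → i ≢ j → Contraction Φ i j X → i ∉ X
  contraction-∌ _ (inj₁ (_ , i∉X)) = i∉X
  contraction-∌ i≢j (inj₂ (_ , _ , _ , refl)) i∈X with ∈∪⁻ i∈X
  ... | inj₁ i∈F-i = proj₂ (∈-⁻ i∈F-i) refl
  ... | inj₂ i∈j = i≢j (x∈⁅y⁆⇒x≡y _ i∈j)

  squarefree : Subset n → Monomial n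
  squarefree F k with k ∈? F
  ... | yes _ = 1
  ... | no _ = 0

  squarefree-∈ : ∀ {F k} → k ∈ F → squarefree F k ≡ 1
  squarefree-∈ {F} {k} k∈F with k ∈? F
  ... | yes _ = refl
  ... | no k∉F = ⊥-elim (k∉F k∈F)

  squarefree-∉ : ∀ {F k} → k ∉ F → squarefree F k ≡ 0
  squarefree-∉ {F} {k} k∉F with k ∈? F
  ... | yes k∈F = ⊥-elim (k∉F k∈F)
  ... | no _ = refl

  squarefree-support : ∀ {F k} → 1 ≤ℕ squarefree F k → k ∈ F
  squarefree-support {F} {k} 1≤xF with k ∈? F | 1≤xF
  ... | yes k∈F | _ = k∈F
  ... | no _ | ()

  sqfreeDivides-squarefree : ∀ F → SqfreeDivides F (squarefree F)
  sqfreeDivides-squarefree F k k∈F rewrite squarefree-∈ k∈F = s≤s z≤n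

  sqfreeDivides⇒squarefree-∣ : ∀ {F a} → SqfreeDivides F a → squarefree F ∣ᵐ a
  sqfreeDivides⇒squarefree-∣ {F} F∣a k with k ∈? F
  ... | yes k∈F = F∣a k k∈F
  ... | no _ = z≤n

module _ {n : ℕ} (Γ : Complex n) (dc : DownClosed ⟦ Γ ⟧) where

  shrink : ∀ (ks : List (Fin n)) F → ¬ ⟦ Γ ⟧ F →
    Σ (Subset n) λ R → R ⊆ F × ¬ ⟦ Γ ⟧ R × (∀ k → k ∈ₗ ks → k ∈ R → ⟦ Γ ⟧ (R - k))
  shrink [] F F∉Γ = F , ⊆-refl , F∉Γ , λ _ ()
  shrink (k ∷ ks) F F∉Γ with Γ (F - k) in F-k∈?Γ
  ... | true with shrink ks F F∉Γ
  ...   | R , R⊆F , R∉Γ , minimal =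
    R , R⊆F , R∉Γ ,
    λ { _ (here refl) _ → dc (p⊆q⇒p-x⊆q-x R⊆F) F-k∈?Γ ; k′ (there k′∈ks) → minimal k′ k′∈ks }
  shrink (k ∷ ks) F F∉Γ | false with shrink ks (F - k) (not-¬ F-k∈?Γ)
  ...   | R , R⊆F-k , R∉Γ , minimal =
    R , proj₁ ∘ ∈-⁻ ∘ R⊆F-k , R∉Γ ,
    λ { _ (here refl) k∈R → ⊥-elim (proj₂ (∈-⁻ (R⊆F-k k∈R)) refl) ; k′ (there k′∈ks) → minimal k′ k′∈ks }

  minimalNonFace-⊆ : ∀ F → ¬ ⟦ Γ ⟧ F → Σ (Subset n) λ R → R ⊆ F × MinimalNonFace ⟦ Γ ⟧ R
  minimalNonFace-⊆ F F∉Γ with shrink (allFin n) F F∉Γ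
  ... | R , R⊆F , R∉Γ , minimal = R , R⊆F , R∉Γ , λ k → minimal k (∈-allFin k)

  minimalGenerator⇒minimalNonFace : ∀ {a} → MinimalGenerator Γ a →
    Σ (Subset n) λ F → MinimalNonFace ⟦ Γ ⟧ F × (∀ k → a k ≡ squarefree F k)
  minimalGenerator⇒minimalNonFace {a} ((F , F∉Γ , F∣a) , minimal) = F , (F∉Γ , facets) , a≡xF
    where
    a≡xF : ∀ k → a k ≡ squarefree F k
    a≡xF k =
      sym (minimal (squarefree F) (sqfreeDivides⇒squarefree-∣ F∣a) (F , F∉Γ , sqfreeDivides-squarefree F) k)
    facets : ∀ k → k ∈ F → ⟦ Γ ⟧ (F - k)
    facets k k∈F with Γ (F - k) in F-k∈?Γ
    ... | true = refl
    ... | false = ⊥-elim (0≢1+n (begin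
      0                     ≡⟨ sym (squarefree-∉ (λ k∈F-k → proj₂ (∈-⁻ k∈F-k) refl)) ⟩
      squarefree (F - k) k  ≡⟨ minimal (squarefree (F - k))
                                 (sqfreeDivides⇒squarefree-∣ (λ k′ → F∣a k′ ∘ proj₁ ∘ ∈-⁻))
                                 (F - k , not-¬ F-k∈?Γ , sqfreeDivides-squarefree (F - k)) k ⟩
      a k                   ≡⟨ a≡xF k ⟩
      squarefree F k        ≡⟨ squarefree-∈ k∈F ⟩
      1                     ∎))
      where open ≡-Reasoning

  minimalNonFace⇒minimalGenerator : ∀ {R} → MinimalNonFace ⟦ Γ ⟧ R → MinimalGenerator Γ (squarefree R)
  minimalNonFace⇒minimalGenerator {R} (R∉Γ , minimal) = (R , R∉Γ , sqfreeDivides-squarefree R) , agrees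
    where
    agrees : ∀ b → b ∣ᵐ squarefree R → InSR Γ b → ∀ k → b k ≡ squarefree R k
    agrees b b∣xR (F , F∉Γ , F∣b) k with k ∈? R
    ... | no k∉R = n≤0⇒n≡0 (subst (b k ≤ℕ_) (squarefree-∉ k∉R) (b∣xR k))
    ... | yes k∈R = ≤-antisym (subst (b k ≤ℕ_) (squarefree-∈ k∈R) (b∣xR k)) (F∣b k k∈F)
      where
      k∈F : k ∈ F
      k∈F with k ∈? F
      ... | yes k∈F = k∈F
      ... | no k∉F = ⊥-elim (F∉Γ (dc F⊆R-k (minimal k k∈R)))
        where
        F⊆R-k : F ⊆ R - k
        F⊆R-k k′∈F =
          x∈p∧x≢y⇒x∈p-y (squarefree-support (≤-trans (F∣b _ k′∈F) (b∣xR _))) λ { refl → k∉F k′∈F }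

  module _ {i j : Fin n} where

    linkClosed⇒∄minimalNonFace : i ≢ j → LinkClosed ⟦ Γ ⟧ i j →
      ∀ R → MinimalNonFace ⟦ Γ ⟧ R → i ∈ R → j ∉ R
    linkClosed⇒∄minimalNonFace i≢j closed R (R∉Γ , minimal) i∈R j∈R =
      R∉Γ (dc (⊆-trans p⊆p─q∪q (∪-monoˡ p⊆p─q∪q)) (closed G G∪i∈Γ G∪j∈Γ))
      where
      G = (R - j) - i
      G∪i∈Γ : ⟦ Γ ⟧ (G ∪ ⁅ i ⁆)
      G∪i∈Γ = dc (∪-lub (proj₁ ∘ ∈-⁻) (x∈p⇒⁅x⁆⊆p (x∈p∧x≢y⇒x∈p-y i∈R i≢j))) (minimal j j∈R)
      G∪j∈Γ : ⟦ Γ ⟧ (G ∪ ⁅ j ⁆)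
      G∪j∈Γ = dc (∪-lub (proj₁ ∘ ∈-⁻ ∘ ⊆-reflexive (p─x─y≡p─y─x R j i))
                         (x∈p⇒⁅x⁆⊆p (x∈p∧x≢y⇒x∈p-y j∈R (i≢j ∘ sym))))
                 (minimal i i∈R)

    ∄minimalNonFace⇒linkClosed : (∀ R → MinimalNonFace ⟦ Γ ⟧ R → i ∈ R → j ∉ R) → LinkClosed ⟦ Γ ⟧ i j
    ∄minimalNonFace⇒linkClosed none G G∪i∈Γ G∪j∈Γ with Γ ((G ∪ ⁅ i ⁆) ∪ ⁅ j ⁆) in G∪ij∈?Γ
    ... | true = refl
    ... | false with minimalNonFace-⊆ _ (not-¬ G∪ij∈?Γ)
    ...   | R , R⊆G∪ij , R∉Γ , minimal =
      ⊥-elim (none R (R∉Γ , minimal) (∈R (⊆-trans R⊆G∪ij (∪-lub (∪-monoˡ ⊆∪ˡ) (⊆∪ˡ ∘ ⊆∪ʳ))) G∪j∈Γ)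
                                     (∈R R⊆G∪ij G∪i∈Γ))
      where
      ∈R : ∀ {H x} → R ⊆ H ∪ ⁅ x ⁆ → ⟦ Γ ⟧ H → x ∈ R
      ∈R {x = x} R⊆H∪x H∈Γ with x ∈? R
      ... | yes x∈R = x∈R
      ... | no x∉R = ⊥-elim (R∉Γ (dc (p⊆q∪⁅x⁆∧x∉p⇒p⊆q R⊆H∪x x∉R) H∈Γ))

    ∃Min⇒minimalNonFace : ∃Min Γ i j → Σ (Subset n) λ R → MinimalNonFace ⟦ Γ ⟧ R × i ∈ R × j ∈ R
    ∃Min⇒minimalNonFace (a , generator , 1≤ai , 1≤aj) with minimalGenerator⇒minimalNonFace generator
    ... | R , R-minimal , a≡xR =
      R , R-minimal ,
      squarefree-support (subst (1 ≤ℕ_) (a≡xR i) 1≤ai) , squarefree-support (subst (1 ≤ℕ_) (a≡xR j) 1≤aj)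

    minimalNonFace⇒∃Min : ∀ {R} → MinimalNonFace ⟦ Γ ⟧ R → i ∈ R → j ∈ R → ∃Min Γ i j
    minimalNonFace⇒∃Min {R} R-minimal i∈R j∈R =
      squarefree R , minimalNonFace⇒minimalGenerator R-minimal ,
      sqfreeDivides-squarefree R i i∈R , sqfreeDivides-squarefree R j j∈R

    linkClosed⇔∄Min : i ≢ j → LinkClosed ⟦ Γ ⟧ i j ⇔ (¬ ∃Min Γ i j)
    linkClosed⇔∄Min i≢j = mk⇔
      (λ closed min → let R , R-minimal , i∈R , j∈R = ∃Min⇒minimalNonFace min in
        linkClosed⇒∄minimalNonFace i≢j closed R R-minimal i∈R j∈R)
      (λ ∄min → ∄minimalNonFace⇒linkClosed λ R R-minimal i∈R j∈R →
        ∄min (minimalNonFace⇒∃Min R-minimal i∈R j∈R))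

module Shifting {n : ℕ} (Γ : Complex n) (dc : DownClosed ⟦ Γ ⟧) {i j : Fin n} (i≢j : i ≢ j) where

  ShiftFormula : Family n
  ShiftFormula = Contraction ⟦ Γ ⟧ i j ∪ᶠ addVertex i (join ⁅ j ⁆ (lk ⟦ Γ ⟧ (⁅ i ⁆ ∪ ⁅ j ⁆)))

  Cij-fixed : ∀ F → (i ∈ F → j ∉ F → ⟦ Γ ⟧ ((F - i) ∪ ⁅ j ⁆)) → Cij Γ i j F ≡ F
  Cij-fixed F fixed with i ∈? F | j ∈? F
  ... | yes i∈F | no j∉F rewrite fixed i∈F j∉F = refl
  ... | yes _ | yes _ = refl
  ... | no _ | _ = refl

  Cij-moved : ∀ F → i ∈ F → j ∉ F → Γ ((F - i) ∪ ⁅ j ⁆) ≡ false → Cij Γ i j F ≡ (F - i) ∪ ⁅ j ⁆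
  Cij-moved F i∈F j∉F moved with i ∈? F | j ∈? F
  ... | yes _ | no _ rewrite moved = refl
  ... | yes _ | yes j∈F = ⊥-elim (j∉F j∈F)
  ... | no i∉F | _ = ⊥-elim (i∉F i∈F)

  data CijView (F : Subset n) : Set where
    fixed : (i ∈ F → j ∉ F → ⟦ Γ ⟧ ((F - i) ∪ ⁅ j ⁆)) → CijView F
    moved : i ∈ F → j ∉ F → Γ ((F - i) ∪ ⁅ j ⁆) ≡ false → CijView F

  cijView : ∀ F → CijView F
  cijView F with i ∈? F | j ∈? F | Γ ((F - i) ∪ ⁅ j ⁆) in F∈?Γ
  ... | no i∉F | _ | _ = fixed (λ i∈F → ⊥-elim (i∉F i∈F))
  ... | yes _ | yes j∈F | _ = fixed (λ _ j∉F → ⊥-elim (j∉F j∈F))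
  ... | yes _ | no _ | true = fixed (λ _ _ → F∈?Γ)
  ... | yes i∈F | no j∉F | false = moved i∈F j∉F F∈?Γ

  contracted⊆ : ∀ {F} → j ∈ F → (F - i) ∪ ⁅ j ⁆ ⊆ F
  contracted⊆ j∈F = ∪-lub (proj₁ ∘ ∈-⁻) (x∈p⇒⁅x⁆⊆p j∈F)

  formula-∋i⁺ : ∀ {X} → i ∈ X → ⟦ Γ ⟧ (X ∪ ⁅ j ⁆) → ShiftFormula X
  formula-∋i⁺ i∈X X∪j∈Γ = inj₂ (from (addVertex-join-lk dc _) (i∈X , X∪j∈Γ))

  formula-∋i⁻ : ∀ {X} → ShiftFormula X → i ∈ X → ⟦ Γ ⟧ (X ∪ ⁅ j ⁆)
  formula-∋i⁻ (inj₁ contracted) i∈X = ⊥-elim (contraction-∌ i≢j contracted i∈X)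
  formula-∋i⁻ (inj₂ cone) _ = proj₂ (to (addVertex-join-lk dc _) cone)

  shift⊇formula : ∀ X → ShiftFormula X → Shift Γ i j X
  shift⊇formula X (inj₁ (inj₁ (X∈Γ , i∉X))) = X , X∈Γ , Cij-fixed X (λ i∈X → ⊥-elim (i∉X i∈X))
  shift⊇formula _ (inj₁ contracted@(inj₂ (F , F∈Γ , i∈F , refl))) with Γ ((F - i) ∪ ⁅ j ⁆) in X∈?Γ
  ... | true = _ , X∈?Γ , Cij-fixed _ (λ i∈X → ⊥-elim (contraction-∌ i≢j contracted i∈X))
  ... | false = F , F∈Γ , Cij-moved F i∈F j∉F X∈?Γ
    where
    j∉F : j ∉ F
    j∉F j∈F = not-¬ X∈?Γ (dc (contracted⊆ j∈F) F∈Γ)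
  shift⊇formula X (inj₂ cone) with to (addVertex-join-lk dc X) cone
  ... | _ , X∪j∈Γ = X , dc ⊆∪ˡ X∪j∈Γ , Cij-fixed X (λ _ _ → dc (∪-monoˡ (proj₁ ∘ ∈-⁻)) X∪j∈Γ)

  shift⊆formula : LinkClosed ⟦ Γ ⟧ i j → ∀ X → Shift Γ i j X → ShiftFormula X
  shift⊆formula closed _ (F , F∈Γ , refl) with cijView F
  ... | moved i∈F j∉F F-i∪j∉Γ =
    subst ShiftFormula (sym (Cij-moved F i∈F j∉F F-i∪j∉Γ)) (inj₁ (inj₂ (F , F∈Γ , i∈F , refl)))
  ... | fixed F-i∪j∈Γ = subst ShiftFormula (sym (Cij-fixed F F-i∪j∈Γ)) F∈formula
    where
    F∈formula : ShiftFormula F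
    F∈formula with i ∈? F | j ∈? F
    ... | no i∉F | _ = inj₁ (inj₁ (F∈Γ , i∉F))
    ... | yes i∈F | yes j∈F = formula-∋i⁺ i∈F (dc (∪-lub ⊆-refl (x∈p⇒⁅x⁆⊆p j∈F)) F∈Γ)
    ... | yes i∈F | no j∉F =
      formula-∋i⁺ i∈F (dc (∪-monoˡ p⊆p─q∪q) (closed (F - i) F-i∪i∈Γ (F-i∪j∈Γ i∈F j∉F)))
      where
      F-i∪i∈Γ : ⟦ Γ ⟧ ((F - i) ∪ ⁅ i ⁆)
      F-i∪i∈Γ = dc (∪-lub (proj₁ ∘ ∈-⁻) (x∈p⇒⁅x⁆⊆p i∈F)) F∈Γ

  shift≐formula : LinkClosed ⟦ Γ ⟧ i j → Shift Γ i j ≐ ShiftFormula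
  shift≐formula closed X = mk⇔ (shift⊆formula closed X) (shift⊇formula X)

  shift≐formula⇒linkClosed : Shift Γ i j ≐ ShiftFormula → LinkClosed ⟦ Γ ⟧ i j
  shift≐formula⇒linkClosed shift≐ G G∪i∈Γ G∪j∈Γ =
    formula-∋i⁻ (to (shift≐ (G ∪ ⁅ i ⁆)) (_ , G∪i∈Γ , Cij-fixed _ λ _ _ → dc (∪-monoˡ p∪q─q⊆p) G∪j∈Γ))
                (⊆∪ʳ (x∈⁅x⁆ i))

  shift-∋i : LinkClosed ⟦ Γ ⟧ i j → ∀ {X} → i ∈ X → Shift Γ i j X ⇔ ⟦ Γ ⟧ (X ∪ ⁅ j ⁆)
  shift-∋i closed i∈X = mk⇔ (λ X∈shift → formula-∋i⁻ (shift⊆formula closed _ X∈shift) i∈X)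
                            (shift⊇formula _ ∘ formula-∋i⁺ i∈X)

  shift-linkCondition : LinkClosed ⟦ Γ ⟧ i j → LinkCondition (Shift Γ i j) i j
  shift-linkCondition closed = linkCondition-intro {Φ = Shift Γ i j} merge split
    where
    i∈G∪i : ∀ {G} → i ∈ G ∪ ⁅ i ⁆
    i∈G∪i = ⊆∪ʳ (x∈⁅x⁆ i)
    i∈G∪ij : ∀ {G} → i ∈ G ∪ (⁅ i ⁆ ∪ ⁅ j ⁆)
    i∈G∪ij = ⊆∪ʳ (⊆∪ˡ (x∈⁅x⁆ i))
    merge : ∀ G → Disjoint G (⁅ i ⁆ ∪ ⁅ j ⁆) → Shift Γ i j (G ∪ ⁅ i ⁆) → Shift Γ i j (G ∪ ⁅ j ⁆) →
            Shift Γ i j (G ∪ (⁅ i ⁆ ∪ ⁅ j ⁆))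
    merge G _ G∪i∈shift _ =
      from (shift-∋i closed i∈G∪ij)
           (dc (∪-lub (∪-lub (⊆∪ˡ ∘ ⊆∪ˡ) (∪-monoˡ ⊆∪ʳ)) ⊆∪ʳ) (to (shift-∋i closed i∈G∪i) G∪i∈shift))
    split : ∀ G → Disjoint G (⁅ i ⁆ ∪ ⁅ j ⁆) → Shift Γ i j (G ∪ (⁅ i ⁆ ∪ ⁅ j ⁆)) →
            Shift Γ i j (G ∪ ⁅ i ⁆) × Shift Γ i j (G ∪ ⁅ j ⁆)
    split G G∩ij=∅ G∪ij∈shift =
      from (shift-∋i closed i∈G∪i) (dc (∪-monoˡ (∪-lub ⊆∪ˡ (⊆∪ʳ ∘ ⊆∪ˡ))) G∪ij∪j∈Γ) ,
      shift⊇formula _ (inj₁ (inj₁ (dc (∪-lub (⊆∪ˡ ∘ ⊆∪ˡ) ⊆∪ʳ) G∪ij∪j∈Γ , i∉G∪j)))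
      where
      G∪ij∪j∈Γ : ⟦ Γ ⟧ ((G ∪ (⁅ i ⁆ ∪ ⁅ j ⁆)) ∪ ⁅ j ⁆)
      G∪ij∪j∈Γ = to (shift-∋i closed i∈G∪ij) G∪ij∈shift
      i∉G∪j : i ∉ G ∪ ⁅ j ⁆
      i∉G∪j = [ (λ i∈G → G∩ij=∅ i i∈G (⊆∪ˡ (x∈⁅x⁆ i))) , i≢j ∘ x∈⁅y⁆⇒x≡y j ] ∘ ∈∪⁻

lemma2p1 : ∀ (n : ℕ) (Γ : Complex n) → IsSimplicialComplex Γ →
    ∀ (i j : Fin n) → i < j →
      (LinkCondition ⟦ Γ ⟧ i j
         ⇔ (Shift Γ i j ≐ (Contraction ⟦ Γ ⟧ i j
              ∪ᶠ addVertex i (join ⁅ j ⁆ (lk ⟦ Γ ⟧ (⁅ i ⁆ ∪ ⁅ j ⁆))))))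
      × (LinkCondition ⟦ Γ ⟧ i j
         ⇔ (¬ (∃Min Γ i j)))
      × (LinkCondition ⟦ Γ ⟧ i j → LinkCondition (Shift Γ i j) i j)
lemma2p1 n Γ sc i j i<j =
  mk⇔ (shift≐formula ∘ closed) (linkCondition ∘ shift≐formula⇒linkClosed) ,
  mk⇔ (to (linkClosed⇔∄Min Γ dc i≢j) ∘ closed) (linkCondition ∘ from (linkClosed⇔∄Min Γ dc i≢j)) ,
  shift-linkCondition ∘ closed
  where
  i≢j : i ≢ j
  i≢j = <⇒≢ i<j
  dc : DownClosed ⟦ Γ ⟧
  dc {F} {G} = IsSimplicialComplex.downClosed sc F G
  closed : LinkCondition ⟦ Γ ⟧ i j → LinkClosed ⟦ Γ ⟧ i j
  closed = linkCondition⇒linkClosed dc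
  linkCondition : LinkClosed ⟦ Γ ⟧ i j → LinkCondition ⟦ Γ ⟧ i j
  linkCondition = linkClosed⇒linkCondition dc
  open Shifting Γ dc i≢j
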